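{- Let $M=\{1,\dots,m\}$, $N=\{1,\dots,n\}$, let $S_j\subseteq M$ and $c_j>0$ for $j\in N$, let $b_i\in\mathbb{Z}_{\ge 0}$ for $i\in M$, let $\{G_1,\dots,G_k\}$ be a partition of $N$ and $d_h\le |G_h|$ nonnegative integers for $h\in K=\{1,\dots,k\}$. Let $\bm{w}\in\mathbb{R}_{\ge 0}^m$ and let $\bm{x}\in\{0,1\}^n$ satisfy $\sum_{j\in G_h}x_j\le d_h$ for all $h\in K$, and suppose $\bm{x}$ is locally optimal with respect to the 1-flip neighborhood (no GUB-feasible $\bm{x}'$ differing from $\bm{x}$ in exactly one coordinate has $\hat z(\bm{x}',\bm{w})<\hat z(\bm{x},\bm{w})$). Suppose that for a block $G_h$ and indices $j_1,j_2\in G_h$ with $x_{j_1}=1$ and $x_{j_2}=0$ we have $\Delta\hat z_{j_1,j_2}(\bm{x},\bm{w})<0$, $M_E(\bm{x})\cap S_{j_1}\cap S_{j_2}=\emptyset$, and $\sum_{j\in G_h}x_j=d_h$. Let $j_1^*$ be a minimizer of $\Delta\hat z^{\downarrow}_j(\bm{x},\bm{w})$ over $\{j\in G_h\mid x_j=1\}$ and $j_2^*$ a minimizer of $\Delta\hat z^{\uparrow}_j(\bm{x},\bm{w})$ over $\{j\in G_h\mid x_j=0\}$. Then $\Delta\hat z_{j_1^*,j_2^*}(\bm{x},\bm{w})<0$.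
   Context: Write $a_{ij}=1$ if $i\in S_j$ and $a_{ij}=0$ otherwise. The penalized objective is $\hat z(\bm{x},\bm{w})=\sum_{j\in N}c_jx_j+\sum_{i\in M}w_i\max\{b_i-\sum_{j\in N}a_{ij}x_j,0\}$. Let $M_L(\bm{x})=\{i\in M\mid \sum_{j\in N}a_{ij}x_j<b_i\}$ and $M_E(\bm{x})=\{i\in M\mid \sum_{j\in N}a_{ij}x_j=b_i\}$. For $j$ with $x_j=0$, $\Delta\hat z^{\uparrow}_j(\bm{x},\bm{w})=c_j-\sum_{i\in M_L(\bm{x})\cap S_j}w_i$ (the increase of $\hat z$ when flipping $x_j$ from 0 to 1); for $j$ with $x_j=1$, $\Delta\hat z^{\downarrow}_j(\bm{x},\bm{w})=-c_j+\sum_{i\in(M_L(\bm{x})\cup M_E(\bm{x}))\cap S_j}w_i$ (the increase of $\hat z$ when flipping $x_j$ from 1 to 0). $\Delta\hat z_{j_1,j_2}(\bm{x},\bm{w})$ denotes $\hat z(\bm{x}',\bm{w})-\hat z(\bm{x},\bm{w})$ where $\bm{x}'$ is obtained from $\bm{x}$ by flipping $x_{j_1}$ and $x_{j_2}$ simultaneously. Throughout, only solutions satisfying the GUB constraints are considered.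
   Formalization: The costs $c_j$ and the weights $\bm{w}$ take values in ℚ instead of ℝ. -}

module Defs where

open import Data.Nat as ℕ using (ℕ; zero; suc; _∸_)
open import Data.Fin using (Fin; zero; suc; _≟_)
open import Data.Bool using (Bool; true; false; if_then_else_; not; _∧_)
open import Data.Integer using (+_)
open import Data.Rational using (ℚ; 0ℚ; _+_; _*_; _-_; -_; _/_; _≤_)
open import Relation.Nullary.Decidable using (⌊_⌋)
open import Relation.Binary.PropositionalEquality using (_≡_)

Σℚ : (n : ℕ) → (Fin n → ℚ) → ℚ
Σℚ zero    f = 0ℚ
Σℚ (suc n) f = f zero + Σℚ n (λ j → f (suc j))

Σℕ : (n : ℕ) → (Fin n → ℕ) → ℕ
Σℕ zero    f = 0
Σℕ (suc n) f = f zero ℕ.+ Σℕ n (λ j → f (suc j))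

count : (n : ℕ) → (Fin n → Bool) → ℕ
count n p = Σℕ n (λ j → if p j then 1 else 0)

toℚ : ℕ → ℚ
toℚ k = (+ k) / 1

-- Instance data:  S j i = true  iff  i ∈ S_j  (i.e. a_ij = 1).
-- The partition {G_1..G_k} of N is given by grp : Fin n → Fin k, G_h = {j | grp j ≡ h}.

inG : {n k : ℕ} → (Fin n → Fin k) → Fin k → Fin n → Bool
inG grp h j = ⌊ grp j ≟ h ⌋

blockSize : {n k : ℕ} → (Fin n → Fin k) → Fin k → ℕ
blockSize {n} grp h = count n (inG grp h)

blockLoad : {n k : ℕ} → (Fin n → Fin k) → (Fin n → Bool) → Fin k → ℕ
blockLoad {n} grp x h = count n (λ j → inG grp h j ∧ x j)

GUBFeasible : {n k : ℕ} → (Fin n → Fin k) → (Fin k → ℕ) → (Fin n → Bool) → Set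
GUBFeasible grp d x = ∀ h → blockLoad grp x h ℕ.≤ d h

cover : {m n : ℕ} → (Fin n → Fin m → Bool) → (Fin n → Bool) → Fin m → ℕ
cover {m} {n} S x i = count n (λ j → S j i ∧ x j)

-- penalized objective  ẑ(x,w) = Σ c_j x_j + Σ w_i max{b_i − Σ_j a_ij x_j, 0}
-- (for naturals, max{b − a, 0} = b ∸ a)
zhat : {m n : ℕ} → (Fin n → Fin m → Bool) → (Fin n → ℚ) → (Fin m → ℕ) →
       (Fin n → Bool) → (Fin m → ℚ) → ℚ
zhat {m} {n} S c b x w =
  Σℚ n (λ j → if x j then c j else 0ℚ)
  + Σℚ m (λ i → w i * toℚ (b i ∸ cover S x i))

flip : {n : ℕ} → (Fin n → Bool) → Fin n → Fin n → Bool
flip x j j' = if ⌊ j' ≟ j ⌋ then not (x j') else x j'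

inML : {m n : ℕ} → (Fin n → Fin m → Bool) → (Fin m → ℕ) → (Fin n → Bool) → Fin m → Bool
inML S b x i = ⌊ cover S x i ℕ.<? b i ⌋

inME : {m n : ℕ} → (Fin n → Fin m → Bool) → (Fin m → ℕ) → (Fin n → Bool) → Fin m → Bool
inME S b x i = ⌊ cover S x i ℕ.≟ b i ⌋

Δup : {m n : ℕ} → (Fin n → Fin m → Bool) → (Fin n → ℚ) → (Fin m → ℕ) →
      (Fin n → Bool) → (Fin m → ℚ) → Fin n → ℚ
Δup {m} S c b x w j = c j - Σℚ m (λ i → if inML S b x i ∧ S j i then w i else 0ℚ)

Δdown : {m n : ℕ} → (Fin n → Fin m → Bool) → (Fin n → ℚ) → (Fin m → ℕ) →
        (Fin n → Bool) → (Fin m → ℚ) → Fin n → ℚ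
Δdown {m} S c b x w j =
  - c j + Σℚ m (λ i → if (inML S b x i Data.Bool.∨ inME S b x i) ∧ S j i then w i else 0ℚ)

Δ2 : {m n : ℕ} → (Fin n → Fin m → Bool) → (Fin n → ℚ) → (Fin m → ℕ) →
     (Fin n → Bool) → (Fin m → ℚ) → Fin n → Fin n → ℚ
Δ2 S c b x w j₁ j₂ = zhat S c b (flip (flip x j₁) j₂) w - zhat S c b x w

OneFlipLocalOpt : {m n k : ℕ} → (Fin n → Fin m → Bool) → (Fin n → ℚ) → (Fin m → ℕ) →
                  (Fin n → Fin k) → (Fin k → ℕ) → (Fin n → Bool) → (Fin m → ℚ) → Set
OneFlipLocalOpt S c b grp d x w =
  ∀ j → GUBFeasible grp d (flip x j) → zhat S c b x w ≤ zhat S c b (flip x j) w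

-- Exchanging an element j₁ with x j₁ = 1 for an element j₂ with x j₂ = 0 changes ẑ by
-- Δẑ↓ j₁ + Δẑ↑ j₂ minus the weight of the rows of M_E(x) covered by both S j₁ and S j₂:
-- such a row is uncovered by removing j₁, which Δẑ↓ j₁ charges, and covered again by j₂,
-- which Δẑ↑ j₂ does not credit. All other rows behave as in the two single flips. As weights
-- are nonnegative, Δẑ_{j₁*,j₂*} ≤ Δẑ↓ j₁* + Δẑ↑ j₂* ≤ Δẑ↓ j₁ + Δẑ↑ j₂ by minimality, and the
-- last sum equals Δẑ_{j₁,j₂} < 0 because no row of M_E(x) is covered by both S j₁ and S j₂.
module Submission where

open import Defs
open import Data.Nat using (ℕ)
open import Data.Fin as Fin using (Fin; zero; suc)
open import Data.Bool using (Bool; true; false; not; _∧_; _∨_; if_then_else_)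
open import Data.Product using (∃)
open import Data.Rational using (ℚ; 0ℚ; 1ℚ; mkℚ; _+_; _*_; _-_; -_; _<_; _≤_)
open import Relation.Binary.PropositionalEquality
  using (_≡_; _≢_; refl; sym; trans; cong; cong₂; module ≡-Reasoning)

open import Algebra.Bundles using (CommutativeMonoid)
import Algebra.Properties.CommutativeMonoid.Sum as MonoidSum
import Algebra.Properties.CommutativeSemigroup as CommutativeSemigroupProperties
open import Data.Bool.Properties using (∧-identityʳ; ∧-zeroʳ)
open import Data.Empty using (⊥-elim)
import Data.Integer as ℤ
open import Data.Nat as ℕ using (_∸_; _<?_; _≤?_; s<s; s<s⁻¹)
import Data.Nat.Properties as ℕP
open import Data.Nat.Coprimality using (1-coprimeTo) renaming (sym to coprime-sym)
import Data.Rational.Properties as ℚP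
open import Data.Rational.Solver using (module +-*-Solver)
open import Function.Bundles using (mk⇔)
open import Relation.Nullary using (yes; no; does)
open import Relation.Nullary.Decidable using (⌊_⌋; ⌊⌋-map′; isYes≗does; does-⇔)

𝟙 : Bool → ℕ
𝟙 s = if s then 1 else 0

toℚ-suc : ∀ k → toℚ (ℕ.suc k) ≡ 1ℚ + toℚ k
toℚ-suc k = trans (toℚ-suc-mkℚ k)
  (cong (λ q → 1ℚ + q) (sym (ℚP.normalize-coprime (coprime-sym (1-coprimeTo k)))))
  where
  toℚ-suc-mkℚ : ∀ k → toℚ (ℕ.suc k) ≡ 1ℚ + mkℚ (ℤ.+ k) 0 (coprime-sym (1-coprimeTo k))
  toℚ-suc-mkℚ ℕ.zero    = refl
  toℚ-suc-mkℚ (ℕ.suc k) = ℚP./-cong {ℤ.+ ℕ.suc (ℕ.suc k)} {1}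
    (cong (λ t → ℤ.+ ℕ.suc (ℕ.suc t)) (sym (ℕP.*-identityʳ k))) refl

toℚ-+ : ∀ a b → toℚ (a ℕ.+ b) ≡ toℚ a + toℚ b
toℚ-+ ℕ.zero    b = sym (ℚP.+-identityˡ (toℚ b))
toℚ-+ (ℕ.suc a) b = begin
  toℚ (ℕ.suc (a ℕ.+ b))     ≡⟨ toℚ-suc (a ℕ.+ b) ⟩
  1ℚ + toℚ (a ℕ.+ b)        ≡⟨ cong (λ q → 1ℚ + q) (toℚ-+ a b) ⟩
  1ℚ + (toℚ a + toℚ b)      ≡⟨ ℚP.+-assoc 1ℚ (toℚ a) (toℚ b) ⟨
  (1ℚ + toℚ a) + toℚ b      ≡⟨ cong (λ q → q + toℚ b) (toℚ-suc a) ⟨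
  toℚ (ℕ.suc a) + toℚ b     ∎
  where open ≡-Reasoning

*-toℚ-+ : ∀ w a b → w * toℚ (a ℕ.+ b) ≡ w * toℚ a + w * toℚ b
*-toℚ-+ w a b = trans (cong (w *_) (toℚ-+ a b)) (ℚP.*-distribˡ-+ w (toℚ a) (toℚ b))

*-toℚ-𝟙 : ∀ w s → w * toℚ (𝟙 s) ≡ (if s then w else 0ℚ)
*-toℚ-𝟙 w true  = ℚP.*-identityʳ w
*-toℚ-𝟙 w false = ℚP.*-zeroʳ w

p≤p+q : ∀ p {q} → 0ℚ ≤ q → p ≤ p + q
p≤p+q p {q} q≥0 = ℚP.≤-trans (ℚP.≤-reflexive (sym (ℚP.+-identityʳ p))) (ℚP.+-monoʳ-≤ p q≥0)

flip-≢ : ∀ {n} (x : Fin n → Bool) {j j′} → j′ ≢ j → flip x j j′ ≡ x j′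
flip-≢ x {j} {j′} j′≢j with j′ Fin.≟ j
... | yes j′≡j = ⊥-elim (j′≢j j′≡j)
... | no _     = refl

flip-suc : ∀ {n} (x : Fin (ℕ.suc n) → Bool) (j₀ j : Fin n) →
           flip x (suc j₀) (suc j) ≡ flip (λ k → x (suc k)) j₀ j
flip-suc x j₀ j =
  cong (λ t → if t then not (x (suc j)) else x (suc j)) (⌊⌋-map′ _ _ (j Fin.≟ j₀))

module _ {a ℓ} (M : CommutativeMonoid a ℓ) where
  open CommutativeMonoid M
    using (Carrier; _≈_; _∙_; assoc; ∙-congˡ; ∙-congʳ; setoid; commutativeSemigroup)
  open MonoidSum M using (sum; sum-cong-≗)
  open CommutativeSemigroupProperties commutativeSemigroup
    using (xy∙z≈zy∙x; xy∙z≈xz∙y; x∙yz≈xz∙y)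
  open import Relation.Binary.Reasoning.Setoid setoid

  sum-flip : ∀ {n} (u : Fin n → Bool → Carrier) (x : Fin n → Bool) (j₀ : Fin n) {s} →
             x j₀ ≡ s →
             sum (λ j → u j (flip x j₀ j)) ∙ u j₀ s ≈ sum (λ j → u j (x j)) ∙ u j₀ (not s)
  sum-flip u x zero    refl = xy∙z≈zy∙x _ _ _
  sum-flip u x (suc j₀) {s} x[j₀]≡s = begin
    (u zero (x zero) ∙ sum (λ j → u (suc j) (flip x (suc j₀) (suc j)))) ∙ u (suc j₀) s
      ≈⟨ assoc _ _ _ ⟩
    u zero (x zero) ∙ (sum (λ j → u (suc j) (flip x (suc j₀) (suc j))) ∙ u (suc j₀) s)
      ≡⟨ cong (λ t → u zero (x zero) ∙ (t ∙ u (suc j₀) s))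
              (sum-cong-≗ (λ j → cong (u (suc j)) (flip-suc x j₀ j))) ⟩
    u zero (x zero) ∙ (sum (λ j → u (suc j) (flip (λ k → x (suc k)) j₀ j)) ∙ u (suc j₀) s)
      ≈⟨ ∙-congˡ (sum-flip (λ j → u (suc j)) (λ j → x (suc j)) j₀ x[j₀]≡s) ⟩
    u zero (x zero) ∙ (sum (λ j → u (suc j) (x (suc j))) ∙ u (suc j₀) (not s))
      ≈⟨ assoc _ _ _ ⟨
    (u zero (x zero) ∙ sum (λ j → u (suc j) (x (suc j)))) ∙ u (suc j₀) (not s)
      ∎

  sum-swap : ∀ {n} (u : Fin n → Bool → Carrier) (x : Fin n → Bool) {j₁ j₂ : Fin n} →
             x j₁ ≡ true → x j₂ ≡ false →
             sum (λ j → u j (flip (flip x j₁) j₂ j)) ∙ (u j₁ true ∙ u j₂ false)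
               ≈ sum (λ j → u j (x j)) ∙ (u j₁ false ∙ u j₂ true)
  sum-swap u x {j₁} {j₂} x[j₁]≡true x[j₂]≡false = begin
    sum (λ j → u j (flip x′ j₂ j)) ∙ (u j₁ true ∙ u j₂ false)  ≈⟨ x∙yz≈xz∙y _ _ _ ⟩
    (sum (λ j → u j (flip x′ j₂ j)) ∙ u j₂ false) ∙ u j₁ true  ≈⟨ ∙-congʳ (sum-flip u x′ j₂ x′[j₂]≡false) ⟩
    (sum (λ j → u j (x′ j)) ∙ u j₂ true) ∙ u j₁ true           ≈⟨ xy∙z≈xz∙y _ _ _ ⟩
    (sum (λ j → u j (x′ j)) ∙ u j₁ true) ∙ u j₂ true           ≈⟨ ∙-congʳ (sum-flip u x j₁ x[j₁]≡true) ⟩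
    (sum (λ j → u j (x j)) ∙ u j₁ false) ∙ u j₂ true           ≈⟨ assoc _ _ _ ⟩
    sum (λ j → u j (x j)) ∙ (u j₁ false ∙ u j₂ true)           ∎
    where
    x′ : Fin _ → Bool
    x′ = flip x j₁
    j₂≢j₁ : j₂ ≢ j₁
    j₂≢j₁ refl with () ← trans (sym x[j₁]≡true) x[j₂]≡false
    x′[j₂]≡false : x′ j₂ ≡ false
    x′[j₂]≡false = trans (flip-≢ x j₂≢j₁) x[j₂]≡false

module ℚΣ = MonoidSum ℚP.+-0-commutativeMonoid
module ℕΣ = MonoidSum ℕP.+-0-commutativeMonoid

Σℚ≡sum : ∀ n (f : Fin n → ℚ) → Σℚ n f ≡ ℚΣ.sum f
Σℚ≡sum ℕ.zero    f = refl
Σℚ≡sum (ℕ.suc n) f = cong (f zero +_) (Σℚ≡sum n (λ j → f (suc j)))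

Σℕ≡sum : ∀ n (f : Fin n → ℕ) → Σℕ n f ≡ ℕΣ.sum f
Σℕ≡sum ℕ.zero    f = refl
Σℕ≡sum (ℕ.suc n) f = cong (f zero ℕ.+_) (Σℕ≡sum n (λ j → f (suc j)))

Σℚ-cong : ∀ n {f g : Fin n → ℚ} → (∀ j → f j ≡ g j) → Σℚ n f ≡ Σℚ n g
Σℚ-cong ℕ.zero    f≗g = refl
Σℚ-cong (ℕ.suc n) f≗g = cong₂ _+_ (f≗g zero) (Σℚ-cong n (λ j → f≗g (suc j)))

Σℚ-zero : ∀ n → Σℚ n (λ _ → 0ℚ) ≡ 0ℚ
Σℚ-zero ℕ.zero    = refl
Σℚ-zero (ℕ.suc n) = trans (ℚP.+-identityˡ _) (Σℚ-zero n)

Σℚ-nonneg : ∀ n (f : Fin n → ℚ) → (∀ j → 0ℚ ≤ f j) → 0ℚ ≤ Σℚ n f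
Σℚ-nonneg ℕ.zero    f f≥0 = ℚP.≤-refl
Σℚ-nonneg (ℕ.suc n) f f≥0 =
  ℚP.+-mono-≤ (f≥0 zero) (Σℚ-nonneg n (λ j → f (suc j)) (λ j → f≥0 (suc j)))

Σℚ-distrib-+ : ∀ n (f g : Fin n → ℚ) → Σℚ n (λ j → f j + g j) ≡ Σℚ n f + Σℚ n g
Σℚ-distrib-+ n f g = begin
  Σℚ n (λ j → f j + g j)    ≡⟨ Σℚ≡sum n _ ⟩
  ℚΣ.sum (λ j → f j + g j)  ≡⟨ ℚΣ.∑-distrib-+ f g ⟩
  ℚΣ.sum f + ℚΣ.sum g       ≡⟨ cong₂ _+_ (Σℚ≡sum n f) (Σℚ≡sum n g) ⟨
  Σℚ n f + Σℚ n g           ∎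
  where open ≡-Reasoning

Σℚ-swap : ∀ {n} (u : Fin n → Bool → ℚ) (x : Fin n → Bool) {j₁ j₂ : Fin n} →
          x j₁ ≡ true → x j₂ ≡ false →
          Σℚ n (λ j → u j (flip (flip x j₁) j₂ j)) + (u j₁ true + u j₂ false)
            ≡ Σℚ n (λ j → u j (x j)) + (u j₁ false + u j₂ true)
Σℚ-swap {n} u x {j₁} {j₂} x[j₁]≡true x[j₂]≡false = begin
  Σℚ n (λ j → u j (flip (flip x j₁) j₂ j)) + (u j₁ true + u j₂ false)
    ≡⟨ cong (_+ (u j₁ true + u j₂ false)) (Σℚ≡sum n _) ⟩
  ℚΣ.sum (λ j → u j (flip (flip x j₁) j₂ j)) + (u j₁ true + u j₂ false)
    ≡⟨ sum-swap ℚP.+-0-commutativeMonoid u x x[j₁]≡true x[j₂]≡false ⟩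
  ℚΣ.sum (λ j → u j (x j)) + (u j₁ false + u j₂ true)
    ≡⟨ cong (_+ (u j₁ false + u j₂ true)) (Σℚ≡sum n _) ⟨
  Σℚ n (λ j → u j (x j)) + (u j₁ false + u j₂ true)
    ∎
  where open ≡-Reasoning

Σℕ-swap : ∀ {n} (u : Fin n → Bool → ℕ) (x : Fin n → Bool) {j₁ j₂ : Fin n} →
          x j₁ ≡ true → x j₂ ≡ false →
          Σℕ n (λ j → u j (flip (flip x j₁) j₂ j)) ℕ.+ (u j₁ true ℕ.+ u j₂ false)
            ≡ Σℕ n (λ j → u j (x j)) ℕ.+ (u j₁ false ℕ.+ u j₂ true)
Σℕ-swap {n} u x {j₁} {j₂} x[j₁]≡true x[j₂]≡false = begin
  Σℕ n (λ j → u j (flip (flip x j₁) j₂ j)) ℕ.+ (u j₁ true ℕ.+ u j₂ false)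
    ≡⟨ cong (ℕ._+ (u j₁ true ℕ.+ u j₂ false)) (Σℕ≡sum n _) ⟩
  ℕΣ.sum (λ j → u j (flip (flip x j₁) j₂ j)) ℕ.+ (u j₁ true ℕ.+ u j₂ false)
    ≡⟨ sum-swap ℕP.+-0-commutativeMonoid u x x[j₁]≡true x[j₂]≡false ⟩
  ℕΣ.sum (λ j → u j (x j)) ℕ.+ (u j₁ false ℕ.+ u j₂ true)
    ≡⟨ cong (ℕ._+ (u j₁ false ℕ.+ u j₂ true)) (Σℕ≡sum n _) ⟨
  Σℕ n (λ j → u j (x j)) ℕ.+ (u j₁ false ℕ.+ u j₂ true)
    ∎
  where open ≡-Reasoning

-- Not definitional: _<?_ is computed by the builtin _<ᵇ_, which is stuck on open terms.
⌊<?⌋-suc : ∀ c b → ⌊ c <? b ⌋ ≡ ⌊ ℕ.suc c <? ℕ.suc b ⌋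
⌊<?⌋-suc c b = begin
  ⌊ c <? b ⌋                ≡⟨ isYes≗does _ ⟩
  does (c <? b)             ≡⟨ does-⇔ (mk⇔ s<s s<s⁻¹) (c <? b) (ℕ.suc c <? ℕ.suc b) ⟩
  does (ℕ.suc c <? ℕ.suc b) ≡⟨ isYes≗does _ ⟨
  ⌊ ℕ.suc c <? ℕ.suc b ⌋    ∎
  where open ≡-Reasoning

∸-split : ∀ b c → b ∸ c ≡ b ∸ ℕ.suc c ℕ.+ 𝟙 ⌊ c <? b ⌋
∸-split ℕ.zero    ℕ.zero    = refl
∸-split ℕ.zero    (ℕ.suc c) = refl
∸-split (ℕ.suc b) ℕ.zero    = ℕP.+-comm 1 b
∸-split (ℕ.suc b) (ℕ.suc c) =
  trans (∸-split b c) (cong (λ t → b ∸ ℕ.suc c ℕ.+ 𝟙 t) (⌊<?⌋-suc c b))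

⌊<?⌋∨⌊≟⌋≡⌊≤?⌋ : ∀ c b → ⌊ c <? b ⌋ ∨ ⌊ c ℕ.≟ b ⌋ ≡ ⌊ c ≤? b ⌋
⌊<?⌋∨⌊≟⌋≡⌊≤?⌋ c b with c <? b | c ℕ.≟ b | c ≤? b
... | yes _   | _       | yes _   = refl
... | yes c<b | _       | no c≰b  = ⊥-elim (c≰b (ℕP.<⇒≤ c<b))
... | no _    | yes _   | yes _   = refl
... | no _    | yes c≡b | no c≰b  = ⊥-elim (c≰b (ℕP.≤-reflexive c≡b))
... | no c≮b  | no c≢b  | yes c≤b = ⊥-elim (c≮b (ℕP.≤∧≢⇒< c≤b c≢b))
... | no _    | no _    | no _    = refl

𝟙-⌊<?⌋∨⌊≟⌋ : ∀ c b → 𝟙 (⌊ c <? b ⌋ ∨ ⌊ c ℕ.≟ b ⌋) ≡ 𝟙 ⌊ c ℕ.≟ b ⌋ ℕ.+ 𝟙 ⌊ c <? b ⌋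
𝟙-⌊<?⌋∨⌊≟⌋ c b with c <? b | c ℕ.≟ b
... | yes c<b | yes c≡b = ⊥-elim (ℕP.<-irrefl c≡b c<b)
... | yes _   | no _    = refl
... | no _    | yes _   = refl
... | no _    | no _    = refl

-- b ∸ c is the deficit max{b − c, 0} of a row covered c times; c′ is its coverage after the exchange.
penalty-swap : ∀ b {c′ c} s₁ s₂ → c′ ℕ.+ 𝟙 s₁ ≡ c ℕ.+ 𝟙 s₂ →
               b ∸ c′ ℕ.+ (𝟙 (⌊ c ℕ.≟ b ⌋ ∧ (s₁ ∧ s₂)) ℕ.+ 𝟙 (⌊ c <? b ⌋ ∧ s₂))
                 ≡ b ∸ c ℕ.+ 𝟙 ((⌊ c <? b ⌋ ∨ ⌊ c ℕ.≟ b ⌋) ∧ s₁)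
penalty-swap b {c′} {c} true true eq
  with refl ← ℕP.+-cancelʳ-≡ 1 c′ c eq
  rewrite ∧-identityʳ ⌊ c ℕ.≟ b ⌋ | ∧-identityʳ ⌊ c <? b ⌋ | ∧-identityʳ (⌊ c <? b ⌋ ∨ ⌊ c ℕ.≟ b ⌋)
  = cong (b ∸ c ℕ.+_) (sym (𝟙-⌊<?⌋∨⌊≟⌋ c b))
penalty-swap b {c′} {c} false false eq
  with refl ← ℕP.+-cancelʳ-≡ 0 c′ c eq
  rewrite ∧-zeroʳ ⌊ c ℕ.≟ b ⌋ | ∧-zeroʳ ⌊ c <? b ⌋ | ∧-zeroʳ (⌊ c <? b ⌋ ∨ ⌊ c ℕ.≟ b ⌋)
  = refl
penalty-swap b {c′} {c} true false eq
  with refl ← trans (ℕP.+-comm 1 c′) (trans eq (ℕP.+-identityʳ c))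
  rewrite ∧-zeroʳ ⌊ c ℕ.≟ b ⌋ | ∧-zeroʳ ⌊ c <? b ⌋ | ∧-identityʳ (⌊ c <? b ⌋ ∨ ⌊ c ℕ.≟ b ⌋)
  = begin
    b ∸ c′ ℕ.+ 0                                   ≡⟨ ℕP.+-identityʳ (b ∸ c′) ⟩
    b ∸ c′                                         ≡⟨ ∸-split b c′ ⟩
    b ∸ c ℕ.+ 𝟙 ⌊ c ≤? b ⌋                          ≡⟨ cong (λ t → b ∸ c ℕ.+ 𝟙 t) (⌊<?⌋∨⌊≟⌋≡⌊≤?⌋ c b) ⟨
    b ∸ c ℕ.+ 𝟙 (⌊ c <? b ⌋ ∨ ⌊ c ℕ.≟ b ⌋)          ∎
  where open ≡-Reasoning
penalty-swap b {c′} {c} false true eq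
  with refl ← trans (ℕP.+-comm 1 c) (trans (sym eq) (ℕP.+-identityʳ c′))
  rewrite ∧-zeroʳ ⌊ c ℕ.≟ b ⌋ | ∧-identityʳ ⌊ c <? b ⌋ | ∧-zeroʳ (⌊ c <? b ⌋ ∨ ⌊ c ℕ.≟ b ⌋)
  = trans (sym (∸-split b c)) (sym (ℕP.+-identityʳ (b ∸ c)))

*-toℚ-penalty-swap : ∀ w b {c′ c} s₁ s₂ → c′ ℕ.+ 𝟙 s₁ ≡ c ℕ.+ 𝟙 s₂ →
  w * toℚ (b ∸ c′)
    + ((if ⌊ c ℕ.≟ b ⌋ ∧ (s₁ ∧ s₂) then w else 0ℚ) + (if ⌊ c <? b ⌋ ∧ s₂ then w else 0ℚ))
  ≡ w * toℚ (b ∸ c) + (if (⌊ c <? b ⌋ ∨ ⌊ c ℕ.≟ b ⌋) ∧ s₁ then w else 0ℚ)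
*-toℚ-penalty-swap w b {c′} {c} s₁ s₂ eq = begin
  w * toℚ (b ∸ c′) + ((if e then w else 0ℚ) + (if u then w else 0ℚ))
    ≡⟨ cong₂ (λ p q → w * toℚ (b ∸ c′) + (p + q)) (*-toℚ-𝟙 w e) (*-toℚ-𝟙 w u) ⟨
  w * toℚ (b ∸ c′) + (w * toℚ (𝟙 e) + w * toℚ (𝟙 u))
    ≡⟨ cong (w * toℚ (b ∸ c′) +_) (*-toℚ-+ w (𝟙 e) (𝟙 u)) ⟨
  w * toℚ (b ∸ c′) + w * toℚ (𝟙 e ℕ.+ 𝟙 u)
    ≡⟨ *-toℚ-+ w (b ∸ c′) (𝟙 e ℕ.+ 𝟙 u) ⟨
  w * toℚ (b ∸ c′ ℕ.+ (𝟙 e ℕ.+ 𝟙 u))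
    ≡⟨ cong (λ k → w * toℚ k) (penalty-swap b s₁ s₂ eq) ⟩
  w * toℚ (b ∸ c ℕ.+ 𝟙 d)
    ≡⟨ *-toℚ-+ w (b ∸ c) (𝟙 d) ⟩
  w * toℚ (b ∸ c) + w * toℚ (𝟙 d)
    ≡⟨ cong (w * toℚ (b ∸ c) +_) (*-toℚ-𝟙 w d) ⟩
  w * toℚ (b ∸ c) + (if d then w else 0ℚ)
    ∎
  where
  open ≡-Reasoning
  e u d : Bool
  e = ⌊ c ℕ.≟ b ⌋ ∧ (s₁ ∧ s₂)
  u = ⌊ c <? b ⌋ ∧ s₂
  d = (⌊ c <? b ⌋ ∨ ⌊ c ℕ.≟ b ⌋) ∧ s₁

overlapWeight : ∀ {m n} → (Fin n → Fin m → Bool) → (Fin m → ℕ) → (Fin n → Bool) →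
                (Fin m → ℚ) → Fin n → Fin n → ℚ
overlapWeight {m} S b x w j₁ j₂ =
  Σℚ m (λ i → if inME S b x i ∧ (S j₁ i ∧ S j₂ i) then w i else 0ℚ)

module SwapMove {m n} (S : Fin n → Fin m → Bool) (b : Fin m → ℕ) (x : Fin n → Bool)
                {j₁ j₂ : Fin n} (x[j₁]≡true : x j₁ ≡ true) (x[j₂]≡false : x j₂ ≡ false) where

  y : Fin n → Bool
  y = flip (flip x j₁) j₂

  cover-swap : ∀ i → cover S y i ℕ.+ 𝟙 (S j₁ i) ≡ cover S x i ℕ.+ 𝟙 (S j₂ i)
  cover-swap i = begin
    cover S y i ℕ.+ 𝟙 s₁
      ≡⟨ cong (cover S y i ℕ.+_) (ℕP.+-identityʳ (𝟙 s₁)) ⟨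
    cover S y i ℕ.+ (𝟙 s₁ ℕ.+ 𝟙 false)
      ≡⟨ cong₂ (λ p q → cover S y i ℕ.+ (𝟙 p ℕ.+ 𝟙 q)) (∧-identityʳ s₁) (∧-zeroʳ s₂) ⟨
    cover S y i ℕ.+ (𝟙 (s₁ ∧ true) ℕ.+ 𝟙 (s₂ ∧ false))
      ≡⟨ Σℕ-swap (λ j s → 𝟙 (S j i ∧ s)) x x[j₁]≡true x[j₂]≡false ⟩
    cover S x i ℕ.+ (𝟙 (s₁ ∧ false) ℕ.+ 𝟙 (s₂ ∧ true))
      ≡⟨ cong₂ (λ p q → cover S x i ℕ.+ (𝟙 p ℕ.+ 𝟙 q)) (∧-zeroʳ s₁) (∧-identityʳ s₂) ⟩
    cover S x i ℕ.+ 𝟙 s₂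
      ∎
    where
    open ≡-Reasoning
    s₁ s₂ : Bool
    s₁ = S j₁ i
    s₂ = S j₂ i

  module _ (c : Fin n → ℚ) (w : Fin m → ℚ) where

    cost : (Fin n → Bool) → ℚ
    cost z = Σℚ n (λ j → if z j then c j else 0ℚ)

    penalty : (Fin n → Bool) → ℚ
    penalty z = Σℚ m (λ i → w i * toℚ (b i ∸ cover S z i))

    ΣD ΣU : ℚ
    ΣD = Σℚ m (λ i → if (inML S b x i ∨ inME S b x i) ∧ S j₁ i then w i else 0ℚ)
    ΣU = Σℚ m (λ i → if inML S b x i ∧ S j₂ i then w i else 0ℚ)

    cost-swap : cost y + (c j₁ + 0ℚ) ≡ cost x + (0ℚ + c j₂)
    cost-swap = Σℚ-swap (λ j s → if s then c j else 0ℚ) x x[j₁]≡true x[j₂]≡false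

    penalty-swap-sum : penalty y + (overlapWeight S b x w j₁ j₂ + ΣU) ≡ penalty x + ΣD
    penalty-swap-sum = begin
      penalty y + (Σℚ m E + Σℚ m U)   ≡⟨ cong (penalty y +_) (Σℚ-distrib-+ m E U) ⟨
      penalty y + Σℚ m (λ i → E i + U i)
        ≡⟨ Σℚ-distrib-+ m _ _ ⟨
      Σℚ m (λ i → w i * toℚ (b i ∸ cover S y i) + (E i + U i))
        ≡⟨ Σℚ-cong m (λ i → *-toℚ-penalty-swap (w i) (b i) (S j₁ i) (S j₂ i) (cover-swap i)) ⟩
      Σℚ m (λ i → w i * toℚ (b i ∸ cover S x i) + D i)
        ≡⟨ Σℚ-distrib-+ m _ _ ⟩
      penalty x + ΣD                  ∎
      where
      open ≡-Reasoning
      E U D : Fin m → ℚ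
      E i = if inME S b x i ∧ (S j₁ i ∧ S j₂ i) then w i else 0ℚ
      U i = if inML S b x i ∧ S j₂ i then w i else 0ℚ
      D i = if (inML S b x i ∨ inME S b x i) ∧ S j₁ i then w i else 0ℚ

    Δ2+overlapWeight≡Δdown+Δup :
      Δ2 S c b x w j₁ j₂ + overlapWeight S b x w j₁ j₂ ≡ Δdown S c b x w j₁ + Δup S c b x w j₂
    Δ2+overlapWeight≡Δdown+Δup = begin
      ((A′ + P′) - (A + P)) + E
        ≡⟨ solve 9 (λ A′ A P′ P c₁ c₂ E U D →
                      ((A′ :+ P′) :- (A :+ P)) :+ E
                   := ((A′ :+ (c₁ :+ con 0ℚ)) :+ (P′ :+ (E :+ U))) :- ((A :+ P) :+ (c₁ :+ U)))
                 refl A′ A P′ P (c j₁) (c j₂) E ΣU ΣD ⟩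
      ((A′ + (c j₁ + 0ℚ)) + (P′ + (E + ΣU))) - ((A + P) + (c j₁ + ΣU))
        ≡⟨ cong₂ (λ p q → (p + q) - ((A + P) + (c j₁ + ΣU))) cost-swap penalty-swap-sum ⟩
      ((A + (0ℚ + c j₂)) + (P + ΣD)) - ((A + P) + (c j₁ + ΣU))
        ≡⟨ solve 9 (λ A′ A P′ P c₁ c₂ E U D →
                      ((A :+ (con 0ℚ :+ c₂)) :+ (P :+ D)) :- ((A :+ P) :+ (c₁ :+ U))
                   := (:- c₁ :+ D) :+ (c₂ :- U))
                 refl A′ A P′ P (c j₁) (c j₂) E ΣU ΣD ⟩
      (- c j₁ + ΣD) + (c j₂ - ΣU)
        ∎
      where
      open ≡-Reasoning
      open +-*-Solver
      A A′ P P′ E : ℚ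
      A  = cost x
      A′ = cost y
      P  = penalty x
      P′ = penalty y
      E  = overlapWeight S b x w j₁ j₂

overlapWeight-nonneg : ∀ {m n} (S : Fin n → Fin m → Bool) b x {w : Fin m → ℚ} j₁ j₂ →
                       (∀ i → 0ℚ ≤ w i) → 0ℚ ≤ overlapWeight S b x w j₁ j₂
overlapWeight-nonneg {m} S b x {w} j₁ j₂ w≥0 = Σℚ-nonneg m _ λ i → if-nonneg _ (w≥0 i)
  where
  if-nonneg : ∀ s {v} → 0ℚ ≤ v → 0ℚ ≤ (if s then v else 0ℚ)
  if-nonneg true  v≥0 = v≥0
  if-nonneg false _   = ℚP.≤-refl

overlapWeight-disjoint : ∀ {m n} (S : Fin n → Fin m → Bool) b x (w : Fin m → ℚ) j₁ j₂ →
                         (∀ i → S j₁ i ≡ true → S j₂ i ≡ true → inME S b x i ≢ true) →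
                         overlapWeight S b x w j₁ j₂ ≡ 0ℚ
overlapWeight-disjoint {m} S b x w j₁ j₂ disjoint =
  trans (Σℚ-cong m λ i → if-disjoint (inME S b x i) (S j₁ i) (S j₂ i) (disjoint i)) (Σℚ-zero m)
  where
  if-disjoint : ∀ e s t {v} → (s ≡ true → t ≡ true → e ≢ true) → (if e ∧ (s ∧ t) then v else 0ℚ) ≡ 0ℚ
  if-disjoint true  true  true  ¬e    = ⊥-elim (¬e refl refl refl)
  if-disjoint true  true  false _     = refl
  if-disjoint true  false _     _     = refl
  if-disjoint false _     _     _     = refl

lemma3 : (m n k : ℕ)
    → (S : Fin n → Fin m → Bool) (c : Fin n → ℚ) (b : Fin m → ℕ)
    → (grp : Fin n → Fin k) (d : Fin k → ℕ)
    → (∀ j → 0ℚ < c j)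
    → (∀ h → ∃ λ j → grp j ≡ h)
    → (∀ h → d h Data.Nat.≤ blockSize grp h)
    → (w : Fin m → ℚ) → (∀ i → 0ℚ ≤ w i)
    → (x : Fin n → Bool)
    → GUBFeasible grp d x
    → OneFlipLocalOpt S c b grp d x w
    → (h : Fin k) (j₁ j₂ : Fin n)
    → grp j₁ ≡ h → grp j₂ ≡ h
    → x j₁ ≡ true → x j₂ ≡ false
    → Δ2 S c b x w j₁ j₂ < 0ℚ
    → (∀ i → S j₁ i ≡ true → S j₂ i ≡ true → inME S b x i ≢ true)
    → blockLoad grp x h ≡ d h
    → (j₁* j₂* : Fin n)
    → grp j₁* ≡ h → x j₁* ≡ true
    → (∀ j → grp j ≡ h → x j ≡ true → Δdown S c b x w j₁* ≤ Δdown S c b x w j)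
    → grp j₂* ≡ h → x j₂* ≡ false
    → (∀ j → grp j ≡ h → x j ≡ false → Δup S c b x w j₂* ≤ Δup S c b x w j)
    → Δ2 S c b x w j₁* j₂* < 0ℚ
lemma3 m n k S c b grp d _ _ _ w w≥0 x _ _ h j₁ j₂ grp[j₁]≡h grp[j₂]≡h x[j₁]≡true x[j₂]≡false
       Δ2<0 disjoint _ j₁* j₂* _ x[j₁*]≡true j₁*-minimal _ x[j₂*]≡false j₂*-minimal = begin-strict
  Δ2 S c b x w j₁* j₂*
    ≤⟨ p≤p+q _ (overlapWeight-nonneg S b x j₁* j₂* w≥0) ⟩
  Δ2 S c b x w j₁* j₂* + overlapWeight S b x w j₁* j₂*
    ≡⟨ SwapMove.Δ2+overlapWeight≡Δdown+Δup S b x x[j₁*]≡true x[j₂*]≡false c w ⟩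
  Δdown S c b x w j₁* + Δup S c b x w j₂*
    ≤⟨ ℚP.+-mono-≤ (j₁*-minimal j₁ grp[j₁]≡h x[j₁]≡true) (j₂*-minimal j₂ grp[j₂]≡h x[j₂]≡false) ⟩
  Δdown S c b x w j₁ + Δup S c b x w j₂
    ≡⟨ SwapMove.Δ2+overlapWeight≡Δdown+Δup S b x x[j₁]≡true x[j₂]≡false c w ⟨
  Δ2 S c b x w j₁ j₂ + overlapWeight S b x w j₁ j₂
    ≡⟨ cong (Δ2 S c b x w j₁ j₂ +_) (overlapWeight-disjoint S b x w j₁ j₂ disjoint) ⟩
  Δ2 S c b x w j₁ j₂ + 0ℚ
    ≡⟨ ℚP.+-identityʳ _ ⟩
  Δ2 S c b x w j₁ j₂
    <⟨ Δ2<0 ⟩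
  0ℚ
    ∎
  where open ℚP.≤-Reasoning
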